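{- Let $n \geq 2$ be an integer and $m = \lceil \log_3(2n) \rceil$ (so $m \geq 2$ and $\frac{3^{m-1}+1}{2} \leq n \leq \frac{3^m-1}{2}$). (a) If $\frac{3^{m-1}+1}{2} \leq n \leq \frac{3^{m-1}+1}{2} + 3^{m-2}$, then $$t(n) = \sum_{R_{m-1}=\left\lceil \frac{n-1}{3} \right\rceil}^{\left\lfloor \frac{2n+3^{m-2}-1}{4} \right\rfloor} t(R_{m-1}) \;-\; \sum_{R_{m-1}=\left\lceil \frac{3n+2}{5} \right\rceil}^{\left\lfloor \frac{2n+3^{m-2}-1}{4} \right\rfloor} \; \sum_{R_{m-2}=\left\lceil \frac{R_{m-1}-1}{3} \right\rceil}^{2R_{m-1}-n-1} t(R_{m-2}).$$ (b) If $\frac{3^{m-1}+1}{2} + 3^{m-2} + 1 \leq n \leq \frac{3^m-1}{2}$, then $$t(n) = \sum_{R_{m-1}=\left\lceil \frac{n-1}{3} \right\rceil}^{\frac{3^{m-1}-1}{2}} t(R_{m-1}).$$ (Here $R_{m-1}$ and $R_{m-2}$ are summation indices; empty sums are $0$.)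
   Context: A feasible partition of a positive integer $n$ is a nondecreasing sequence of positive integers $w_1 \leq \dots \leq w_m$ with $w_1 + \dots + w_m = n$ such that (i) every integer $k$ with $1 \leq k \leq n$ can be written as $k = \sum_{i=1}^m u_i w_i$ with each $u_i \in \{ -1,0,1\}$, and (ii) $m$ is the minimum possible number of parts among all sequences of positive integers summing to $n$ with property (i). For a positive integer $n$, $t(n)$ denotes the number of feasible partitions of $n$ (counted as nondecreasing sequences), and by convention $t(0) = 1$. -}

module Defs where

open import Data.Nat using (ℕ; zero; suc; _+_; _*_; _∸_; _≤ᵇ_; _/_)
open import Data.Integer as ℤ using (ℤ; +_)
open import Data.Bool using (Bool; true; false; _∧_; if_then_else_)
open import Data.List using (List; []; _∷_; map; concatMap; upTo; length; filterᵇ; foldr)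
open import Data.Nat.ListAction using (sum)
open import Data.Bool.ListAction using (any; all)
open import Relation.Nullary.Decidable using (⌊_⌋)
open import Data.Nat.Properties using () renaming (_≟_ to _≟ℕ_)

⌈_/_⌉ : ℕ → (b : ℕ) → .{{_ : Data.Nat.NonZero b}} → ℕ
⌈ a / b ⌉ = (a + (b ∸ 1)) / b

range : ℕ → ℕ → List ℕ
range a b = map (λ i → a + i) (upTo (suc b ∸ a))

sumFromTo : ℕ → ℕ → (ℕ → ℕ) → ℕ
sumFromTo a b f = sum (map f (range a b))

signedSums : List ℕ → List ℤ
signedSums [] = + 0 ∷ []
signedSums (w ∷ ws) =
  concatMap (λ s → (s ℤ.- + w) ∷ s ∷ (s ℤ.+ + w) ∷ []) (signedSums ws)

representable : List ℕ → ℤ → Bool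
representable ws k = any (λ s → ⌊ s ℤ.≟ k ⌋) (signedSums ws)

complete : ℕ → List ℕ → Bool
complete n ws = all (λ k → representable ws (+ k)) (range 1 n)

-- all nondecreasing sequences of positive integers, each part ≥ k, summing to n
-- (fuel bounds the recursion depth; fuel ≥ n suffices)
partsFrom : (fuel k n : ℕ) → List (List ℕ)
partsFrom _ k zero = [] ∷ []
partsFrom zero k (suc n) = []
partsFrom (suc f) k (suc n) =
  concatMap (λ w → map (w ∷_) (partsFrom f w (suc n ∸ w))) (range k (suc n))

partitions : ℕ → List (List ℕ)
partitions n = partsFrom n 1 n

min : ℕ → ℕ → ℕ
min a b = if a ≤ᵇ b then a else b

-- minimal number of parts among sequences of positive integers summing to n
-- with property (i).  (Property (i) does not depend on the order of the parts,
-- so it suffices to minimise over partitions; 1+1+…+1 has n parts and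
-- property (i), hence n is a valid initial bound.)
minParts : ℕ → ℕ
minParts n = foldr min n (map length (filterᵇ (λ ws → complete n ws) (partitions n)))

feasible : ℕ → List ℕ → Bool
feasible n ws = complete n ws ∧ ⌊ length ws ≟ℕ minParts n ⌋

t : ℕ → ℕ
t n = length (filterᵇ (λ ws → feasible n ws) (partitions n))

-- A nondecreasing partition of n has property (i) iff each part exceeds twice the sum of
-- the parts before it by at most one (the chain condition).  A chain partition with k parts
-- sums to at most H k = (3^k − 1)/2, and every n ≤ H k is the sum of one, so the feasible
-- partitions of n are the chain partitions with the least k such that n ≤ H k.  Removing the
-- last part n − R of a feasible partition of n leaves a feasible partition q of R, and
-- conversely q ∷ʳ (n − R) is feasible iff n ≤ 3R + 1 and the last part R − r of q is at most
-- n − R, i.e. 2R ≤ n + r.  In case (b) this last condition always holds; in case (a) it also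
-- bounds R by (2n + 3^(m−2) − 1)/4, and the extensions violating it are counted by the
-- double sum, indexed by R and by the sum r of the first m − 2 parts.

module Submission where

open import Defs
open import Data.Nat
  using (ℕ; zero; suc; _+_; _*_; _∸_; _^_; _≤_; _<_; _≤?_; _/_; _%_; _⊓_; _≤ᵇ_; z≤n; s≤s; NonZero)
open import Data.Nat.DivMod using (m≡m%n+[m/n]*n; m%n<n; m/n*n≤m; m<n*o⇒m/o<n; m*n/n≡m)
open import Data.Nat.Properties
import Data.Nat.Tactic.RingSolver as NatSolver
open import Data.Integer using (ℤ; +_; _-_)
import Data.Integer as ℤ
import Data.Integer.Properties as ℤ
import Data.Integer.Tactic.RingSolver as ℤ-Solver
import Algebra.Properties.CommutativeSemigroup ℤ.+-commutativeSemigroup as ℤ+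
open import Data.List
  using (List; []; _∷_; _++_; [_]; _∷ʳ_; map; concatMap; upTo; length; filterᵇ; foldr; initLast; _∷ʳ′_)
open import Data.List.Properties
  using (∷ʳ-injectiveˡ; ++-identityʳ; ++-assoc; length-++; map-cong; length-map; ∷-injectiveʳ)
open import Data.Nat.ListAction using (sum)
open import Data.Nat.ListAction.Properties using (sum-++)
open import Data.List.Membership.Propositional using (_∈_; find)
open import Data.List.Membership.Propositional.Properties
open import Data.List.Membership.Propositional.Properties.WithK using (unique∧set⇒bag)
open import Data.List.Relation.Binary.BagAndSetEquality using (∼bag⇒↭)
open import Data.List.Relation.Binary.Permutation.Propositional.Properties using (↭-length)
open import Data.List.Relation.Unary.Unique.Propositional using (Unique)
import Data.List.Relation.Unary.Unique.Propositional.Properties as Unique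
open import Data.List.Relation.Unary.All using (All; []; _∷_; lookup)
import Data.List.Relation.Unary.All as All
open import Data.List.Relation.Unary.Any using (here; there)
open import Data.List.Relation.Unary.Any.Properties using (any⁺; any⁻)
open import Data.List.Relation.Unary.All.Properties using (all⁺; all⁻)
import Data.List.Relation.Unary.Any as Any
open import Data.List.Relation.Unary.AllPairs using (_∷_)
open import Data.Product using (_×_; _,_; proj₁; proj₂; ∃; ∃₂; map₁)
open import Data.Empty using (⊥-elim)
open import Data.Unit using (⊤; tt)
open import Data.Sum using (_⊎_; inj₁; inj₂)
import Data.Sum
open import Function using (_∘_; _⇔_; mk⇔; case_of_; Equivalence)
open import Relation.Nullary using (¬_; yes; no)
open import Relation.Nullary.Decidable using (⌊_⌋; toWitness; fromWitness; T?)
open import Data.Bool using (T; true; false)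
open import Data.Bool.Properties using (T-∧)
open import Relation.Binary.PropositionalEquality hiding ([_])

private variable
  A B : Set

unique-⇔-length : {xs ys : List A} → Unique xs → Unique ys →
                  (∀ {z} → z ∈ xs ⇔ z ∈ ys) → length xs ≡ length ys
unique-⇔-length xs! ys! xs⇔ys = ↭-length (∼bag⇒↭ (unique∧set⇒bag xs! ys! xs⇔ys))

Unique-concatMap : {xs : List A} {f : A → List B} (key : B → A) → Unique xs →
                   (∀ {x} → x ∈ xs → Unique (f x)) →
                   (∀ {x y} → x ∈ xs → y ∈ f x → key y ≡ x) → Unique (concatMap f xs)
Unique-concatMap {xs = []} key _ _ _ = Unique.[]
Unique-concatMap {xs = x ∷ xs} {f} key (x∉xs ∷ xs!) f! keyed =
  Unique.++⁺ (f! (here refl)) (Unique-concatMap key xs! (f! ∘ there) (keyed ∘ there)) disjoint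
  where
  disjoint : ∀ {y} → ¬ (y ∈ f x × y ∈ concatMap f xs)
  disjoint (y∈fx , y∈rest) with x′ , x′∈xs , y∈fx′ ← find (∈-concatMap⁻ f {xs = xs} y∈rest) =
    lookup x∉xs x′∈xs (trans (sym (keyed (here refl) y∈fx)) (keyed (there x′∈xs) y∈fx′))

length-concatMap : (f : A → List B) (xs : List A) →
                   length (concatMap f xs) ≡ sum (map (length ∘ f) xs)
length-concatMap f [] = refl
length-concatMap f (x ∷ xs) = trans (length-++ (f x)) (cong (_+_ (length (f x))) (length-concatMap f xs))

sum-∷ʳ : ∀ ws w → sum (ws ∷ʳ w) ≡ sum ws + w
sum-∷ʳ ws w = trans (sum-++ ws [ w ]) (cong (_+_ (sum ws)) (+-identityʳ w))

length-∷ʳ : ∀ (ws : List ℕ) w → length (ws ∷ʳ w) ≡ suc (length ws)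
length-∷ʳ ws w = trans (length-++ ws) (+-comm (length ws) 1)

∈-range⁻ : ∀ {a b x} → x ∈ range a b → a ≤ x × x ≤ b
∈-range⁻ {a} {b} x∈ with i , i∈ , refl ← ∈-map⁻ (λ i → a + i) x∈ = m≤m+n a i , ≤-pred (begin-strict
  a + i             <⟨ +-monoʳ-< a i<bound ⟩
  a + (suc b ∸ a)   ≡⟨ m+[n∸m]≡n {a} (<⇒≤ (m∸n≢0⇒n<m λ eq → n≮0 (subst (i <_) eq i<bound))) ⟩
  suc b             ∎)
  where
  open ≤-Reasoning
  i<bound = ∈-upTo⁻ i∈

∈-range⁺ : ∀ {a b x} → a ≤ x → x ≤ b → x ∈ range a b
∈-range⁺ {a} {b} {x} a≤x x≤b = subst (_∈ range a b) (m+[n∸m]≡n a≤x)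
  (∈-map⁺ (λ i → a + i) (∈-upTo⁺ (∸-monoˡ-< (s≤s x≤b) a≤x)))

range-unique : ∀ a b → Unique (range a b)
range-unique a b = Unique.map⁺ (+-cancelˡ-≡ a _ _) (Unique.upTo⁺ _)

m<[1+m/n]*n : ∀ m n .{{_ : NonZero n}} → m < suc (m / n) * n
m<[1+m/n]*n m n = begin-strict
  m                  ≡⟨ m≡m%n+[m/n]*n m n ⟩
  m % n + m / n * n  <⟨ +-monoˡ-< (m / n * n) (m%n<n m n) ⟩
  n + m / n * n      ∎
  where open ≤-Reasoning

m≤n/o⇒m*o≤n : ∀ {m n o} .{{_ : NonZero o}} → m ≤ n / o → m * o ≤ n
m≤n/o⇒m*o≤n {m} {n} {o} m≤ = ≤-trans (*-monoˡ-≤ o m≤) (m/n*n≤m n o)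

m*o≤n⇒m≤n/o : ∀ {m n o} .{{_ : NonZero o}} → m * o ≤ n → m ≤ n / o
m*o≤n⇒m≤n/o {m} {n} {o} m*o≤n = ≮⇒≥ λ n/o<m →
  <⇒≱ (m<[1+m/n]*n n o) (≤-trans (*-monoˡ-≤ o n/o<m) m*o≤n)

⌈m/n⌉≤o⇒m≤o*n : ∀ {m n o} → ⌈ m / suc n ⌉ ≤ o → m ≤ o * suc n
⌈m/n⌉≤o⇒m≤o*n {m} {n} {o} ⌈m/n⌉≤o = +-cancelʳ-≤ n m (o * suc n) (≤-pred (begin-strict
  m + n                        <⟨ m<[1+m/n]*n (m + n) (suc n) ⟩
  suc ((m + n) / suc n) * suc n ≤⟨ *-monoˡ-≤ (suc n) (s≤s ⌈m/n⌉≤o) ⟩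
  suc o * suc n                ≡⟨ cong suc (+-comm n (o * suc n)) ⟩
  suc (o * suc n + n)          ∎))
  where open ≤-Reasoning

m≤o*n⇒⌈m/n⌉≤o : ∀ {m n o} → m ≤ o * suc n → ⌈ m / suc n ⌉ ≤ o
m≤o*n⇒⌈m/n⌉≤o {m} {n} {o} m≤ = ≤-pred (m<n*o⇒m/o<n (begin-strict
  m + n              ≤⟨ +-monoˡ-≤ n m≤ ⟩
  o * suc n + n      <⟨ n<1+n _ ⟩
  suc (o * suc n + n) ≡⟨ cong suc (+-comm (o * suc n) n) ⟩
  suc o * suc n      ∎))
  where open ≤-Reasoning

m∸n≤1+2n⇔m≤1+3n : ∀ {m n} → n ≤ m → m ∸ n ≤ suc (2 * n) ⇔ m ≤ suc (3 * n)
m∸n≤1+2n⇔m≤1+3n {m} {n} n≤m = mk⇔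
  (λ m∸n≤ → begin
    m                     ≡⟨ m+[n∸m]≡n n≤m ⟨
    n + (m ∸ n)           ≤⟨ +-monoʳ-≤ n m∸n≤ ⟩
    n + suc (2 * n)       ≡⟨ tripled n ⟩
    suc (3 * n)           ∎)
  (λ m≤ → m≤n+o⇒m∸n≤o m n (≤-trans m≤ (≤-reflexive (sym (tripled n)))))
  where
  open ≤-Reasoning
  tripled : ∀ n → n + suc (2 * n) ≡ suc (3 * n)
  tripled = NatSolver.solve-∀

+[m+n]-+n≡+m : ∀ m n → + (m + n) - + n ≡ + m
+[m+n]-+n≡+m m n = trans (ℤ.[+m]-[+n]≡m⊖n (m + n) n) (trans (ℤ.⊖-≥ (m≤n+m n m)) (cong +_ (m+n∸n≡m m n)))

-- Partitions

Ascending : ℕ → List ℕ → Set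
Ascending k [] = ⊤
Ascending k (w ∷ ws) = k ≤ w × Ascending w ws

lastOr : ℕ → List ℕ → ℕ
lastOr k [] = k
lastOr k (w ∷ ws) = lastOr w ws

lastOr-∷ʳ : ∀ k ws w → lastOr k (ws ∷ʳ w) ≡ w
lastOr-∷ʳ k [] w = refl
lastOr-∷ʳ k (v ∷ ws) w = lastOr-∷ʳ v ws w

lastOr≤ : ∀ {k K} ws → k ≤ K → sum ws ≤ K → lastOr k ws ≤ K
lastOr≤ [] k≤K _ = k≤K
lastOr≤ (w ∷ ws) _ sum≤K =
  lastOr≤ ws (≤-trans (m≤m+n w (sum ws)) sum≤K) (≤-trans (m≤n+m (sum ws) w) sum≤K)

Ascending-∷ʳ⁺ : ∀ {k w} ws → Ascending k ws → lastOr k ws ≤ w → Ascending k (ws ∷ʳ w)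
Ascending-∷ʳ⁺ [] _ k≤w = k≤w , tt
Ascending-∷ʳ⁺ (v ∷ ws) (k≤v , asc) last≤w = k≤v , Ascending-∷ʳ⁺ ws asc last≤w

Ascending-∷ʳ⁻ : ∀ {k w} ws → Ascending k (ws ∷ʳ w) → Ascending k ws × lastOr k ws ≤ w
Ascending-∷ʳ⁻ [] (k≤w , _) = tt , k≤w
Ascending-∷ʳ⁻ (v ∷ ws) (k≤v , asc) = map₁ (k≤v ,_) (Ascending-∷ʳ⁻ ws asc)

Ascending⇒All≥ : ∀ {k} ws → Ascending k ws → All (k ≤_) ws
Ascending⇒All≥ [] _ = []
Ascending⇒All≥ (w ∷ ws) (k≤w , asc) = k≤w ∷ All.map (≤-trans k≤w) (Ascending⇒All≥ ws asc)

∈-partsFrom⁻ : ∀ f k n {ws} → ws ∈ partsFrom f k n → Ascending k ws × sum ws ≡ n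
∈-partsFrom⁻ f k zero (here refl) = tt , refl
∈-partsFrom⁻ (suc f) k (suc n) ws∈
  with w , w∈ , ws∈′ ← find (∈-concatMap⁻ (λ w → map (w ∷_) (partsFrom f w (suc n ∸ w)))
                                          {xs = range k (suc n)} ws∈)
  with ws′ , ws′∈ , refl ← ∈-map⁻ (w ∷_) ws∈′
  with asc , sum≡ ← ∈-partsFrom⁻ f w (suc n ∸ w) ws′∈
  with k≤w , w≤n ← ∈-range⁻ w∈
  = (k≤w , asc) , trans (cong (_+_ w) sum≡) (m+[n∸m]≡n w≤n)

∈-partsFrom⁺ : ∀ f k {ws} → 1 ≤ k → sum ws ≤ f → Ascending k ws → ws ∈ partsFrom f k (sum ws)
∈-partsFrom⁺ f k {[]} _ _ _ = here refl
∈-partsFrom⁺ f (suc k) {zero ∷ ws} _ _ (() , _)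
∈-partsFrom⁺ zero k {suc w ∷ ws} _ () _
∈-partsFrom⁺ (suc f) k {suc w ∷ ws} 1≤k (s≤s sum≤f) (k≤w , asc) =
  ∈-concatMap⁺ (λ v → map (v ∷_) (partsFrom f v (suc (w + sum ws) ∸ v)))
    (Any.map (λ { refl → ∈-map⁺ (suc w ∷_) ws∈ })
      (∈-range⁺ k≤w (m≤m+n (suc w) (sum ws))))
  where
  ws∈ : ws ∈ partsFrom f (suc w) (w + sum ws ∸ w)
  ws∈ = subst (λ r → ws ∈ partsFrom f (suc w) r) (sym (m+n∸m≡n w (sum ws)))
          (∈-partsFrom⁺ f (suc w) (s≤s z≤n) (≤-trans (m≤n+m (sum ws) w) sum≤f) asc)

partsFrom-unique : ∀ f k n → Unique (partsFrom f k n)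
partsFrom-unique f k zero = [] ∷ Unique.[]
partsFrom-unique zero k (suc n) = Unique.[]
partsFrom-unique (suc f) k (suc n) =
  Unique-concatMap firstPart (range-unique k (suc n))
    (λ {w} _ → Unique.map⁺ ∷-injectiveʳ (partsFrom-unique f w (suc n ∸ w)))
    λ {w} _ ws∈ → case ∈-map⁻ (w ∷_) ws∈ of λ { (_ , _ , refl) → refl }
  where
  firstPart : List ℕ → ℕ
  firstPart [] = 0
  firstPart (w ∷ _) = w

∈-partitions⇔ : ∀ {n ws} → ws ∈ partitions n ⇔ (Ascending 1 ws × sum ws ≡ n)
∈-partitions⇔ {n} {ws} = mk⇔ (∈-partsFrom⁻ n 1 n)
  λ { (asc , refl) → ∈-partsFrom⁺ (sum ws) 1 ≤-refl ≤-refl asc }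

-- Signed sums and the chain condition

data SignedSum : List ℕ → ℤ → Set where
  []    : SignedSum [] (+ 0)
  minus : ∀ {w ws x} → SignedSum ws x → SignedSum (w ∷ ws) (x - + w)
  skip  : ∀ {w ws x} → SignedSum ws x → SignedSum (w ∷ ws) x
  plus  : ∀ {w ws x} → SignedSum ws x → SignedSum (w ∷ ws) (x ℤ.+ + w)

∈-signedSums⁻ : ∀ ws {x} → x ∈ signedSums ws → SignedSum ws x
∈-signedSums⁻ [] (here refl) = []
∈-signedSums⁻ (w ∷ ws) x∈
  with find (∈-concatMap⁻ (λ s → (s - + w) ∷ s ∷ (s ℤ.+ + w) ∷ []) {xs = signedSums ws} x∈)
... | s , s∈ , here refl = minus (∈-signedSums⁻ ws s∈)
... | s , s∈ , there (here refl) = skip (∈-signedSums⁻ ws s∈)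
... | s , s∈ , there (there (here refl)) = plus (∈-signedSums⁻ ws s∈)

∈-signedSums⁺ : ∀ {ws x} → SignedSum ws x → x ∈ signedSums ws
∈-signedSums⁺ [] = here refl
∈-signedSums⁺ {w ∷ ws} σ = ∈-concatMap⁺ (λ s → (s - + w) ∷ s ∷ (s ℤ.+ + w) ∷ []) (∈-three σ)
  where
  ∈-three : ∀ {x} → SignedSum (w ∷ ws) x →
            Any.Any (λ s → x ∈ (s - + w) ∷ s ∷ (s ℤ.+ + w) ∷ []) (signedSums ws)
  ∈-three (minus σ) = Any.map (λ { refl → here refl }) (∈-signedSums⁺ σ)
  ∈-three (skip σ) = Any.map (λ { refl → there (here refl) }) (∈-signedSums⁺ σ)
  ∈-three (plus σ) = Any.map (λ { refl → there (there (here refl)) }) (∈-signedSums⁺ σ)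

representable⇔ : ∀ {ws x} → T (representable ws x) ⇔ SignedSum ws x
representable⇔ {ws} {x} = mk⇔
  (λ r → case find (any⁻ (λ s → ⌊ s ℤ.≟ x ⌋) (signedSums ws) r) of λ
    { (s , s∈ , s≟x) → ∈-signedSums⁻ ws (subst (_∈ signedSums ws) (toWitness s≟x) s∈) })
  (λ σ → any⁺ (λ s → ⌊ s ℤ.≟ x ⌋)
    (Any.map (λ { refl → fromWitness refl }) (∈-signedSums⁺ σ)))

complete⇔ : ∀ {n ws} → T (complete n ws) ⇔ (∀ k → 1 ≤ k → k ≤ n → SignedSum ws (+ k))
complete⇔ {n} {ws} = mk⇔
  (λ c k 1≤k k≤n → Equivalence.to representable⇔
    (lookup (all⁺ (λ k → representable ws (+ k)) (range 1 n) c) (∈-range⁺ 1≤k k≤n)))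
  (λ σ → all⁻ (λ k → representable ws (+ k)) (All.tabulate λ {k} k∈ →
    let 1≤k , k≤n = ∈-range⁻ k∈ in Equivalence.from representable⇔ (σ k 1≤k k≤n)))

SignedSum-neg : ∀ {ws x} → SignedSum ws x → SignedSum ws (ℤ.- x)
SignedSum-neg [] = []
SignedSum-neg {w ∷ _} (minus {x = x} σ) = subst (SignedSum _) (sym (begin
  ℤ.- (x - + w)        ≡⟨ ℤ.neg-distrib-+ x (ℤ.- + w) ⟩
  ℤ.- x ℤ.+ ℤ.- ℤ.- + w ≡⟨ cong (λ y → ℤ.- x ℤ.+ y) (ℤ.neg-involutive (+ w)) ⟩
  ℤ.- x ℤ.+ + w         ∎)) (plus (SignedSum-neg σ))
  where open ≡-Reasoning
SignedSum-neg (skip σ) = skip (SignedSum-neg σ)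
SignedSum-neg {w ∷ _} (plus {x = x} σ) =
  subst (SignedSum _) (sym (ℤ.neg-distrib-+ x (+ w))) (minus (SignedSum-neg σ))

SignedSum-++ : ∀ {p q x y} → SignedSum p x → SignedSum q y → SignedSum (p ++ q) (x ℤ.+ y)
SignedSum-++ {y = y} [] τ = subst (SignedSum _) (sym (ℤ.+-identityˡ y)) τ
SignedSum-++ {w ∷ _} {y = y} (minus {x = x} σ) τ =
  subst (SignedSum _) (ℤ+.xy∙z≈xz∙y x y (ℤ.- + w)) (minus (SignedSum-++ σ τ))
SignedSum-++ (skip σ) τ = skip (SignedSum-++ σ τ)
SignedSum-++ {w ∷ _} {y = y} (plus {x = x} σ) τ =
  subst (SignedSum _) (ℤ+.xy∙z≈xz∙y x y (+ w)) (plus (SignedSum-++ σ τ))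

SignedSum-rotate : ∀ {w ws x} → SignedSum (w ∷ ws) x → SignedSum (ws ∷ʳ w) x
SignedSum-rotate {w} (minus {x = x} σ) =
  subst (SignedSum _) (cong (ℤ._+_ x) (ℤ.+-identityˡ (ℤ.- + w))) (SignedSum-++ σ (minus []))
SignedSum-rotate (skip {x = x} σ) = subst (SignedSum _) (ℤ.+-identityʳ x) (SignedSum-++ σ (skip []))
SignedSum-rotate {w} (plus {x = x} σ) =
  subst (SignedSum _) (cong (ℤ._+_ x) (ℤ.+-identityˡ (+ w))) (SignedSum-++ σ (plus []))

Chain : ℕ → List ℕ → Set
Chain s [] = ⊤
Chain s (w ∷ ws) = w ≤ suc (2 * s) × Chain (s + w) ws

Chain-∷ʳ⁺ : ∀ {s w} ws → Chain s ws → w ≤ suc (2 * (s + sum ws)) → Chain s (ws ∷ʳ w)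
Chain-∷ʳ⁺ {s} {w} [] _ w≤ = subst (λ r → w ≤ suc (2 * r)) (+-identityʳ s) w≤ , tt
Chain-∷ʳ⁺ {s} {w} (v ∷ ws) (v≤ , chain) w≤ =
  v≤ , Chain-∷ʳ⁺ ws chain (subst (λ r → w ≤ suc (2 * r)) (sym (+-assoc s v (sum ws))) w≤)

Chain-∷ʳ⁻ : ∀ {s w} ws → Chain s (ws ∷ʳ w) → Chain s ws × w ≤ suc (2 * (s + sum ws))
Chain-∷ʳ⁻ {s} {w} [] (w≤ , _) = tt , subst (λ r → w ≤ suc (2 * r)) (sym (+-identityʳ s)) w≤
Chain-∷ʳ⁻ {s} {w} (v ∷ ws) (v≤ , chain) with chain′ , w≤ ← Chain-∷ʳ⁻ ws chain =
  (v≤ , chain′) , subst (λ r → w ≤ suc (2 * r)) (+-assoc s v (sum ws)) w≤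

Covers : List ℕ → Set
Covers ws = ∀ k → k ≤ sum ws → SignedSum ws (+ k)

Covers-∷ʳ : ∀ ws {w} → Covers ws → w ≤ suc (2 * sum ws) → Covers (ws ∷ʳ w)
Covers-∷ʳ ws {w} cover w≤ k k≤ with k ≤? sum ws | w ≤? k
... | yes k≤S | _ = SignedSum-rotate (skip (cover k k≤S))
... | no _ | yes w≤k = SignedSum-rotate (subst (SignedSum _) k-w+w (plus (cover (k ∸ w) k-w≤S)))
  where
  k-w≤S : k ∸ w ≤ sum ws
  k-w≤S = m≤n+o⇒m∸n≤o k w (subst (k ≤_) (trans (sum-∷ʳ ws w) (+-comm (sum ws) w)) k≤)
  k-w+w : + (k ∸ w) ℤ.+ + w ≡ + k
  k-w+w = trans (sym (ℤ.pos-+ (k ∸ w) w)) (cong +_ (m∸n+n≡m w≤k))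
... | no S≮k | no w≰k = SignedSum-rotate (subst (SignedSum _) w-[w-k] (plus (SignedSum-neg (cover (w ∸ k) w-k≤S))))
  where
  w-k≤S : w ∸ k ≤ sum ws
  w-k≤S = m≤n+o⇒m∸n≤o w k (≤-trans w≤ (begin
    suc (2 * sum ws)      ≡⟨ cong suc (cong (_+_ (sum ws)) (+-identityʳ (sum ws))) ⟩
    suc (sum ws) + sum ws ≤⟨ +-monoˡ-≤ (sum ws) (≰⇒> S≮k) ⟩
    k + sum ws            ∎))
    where open ≤-Reasoning
  w-[w-k] : ℤ.- + (w ∸ k) ℤ.+ + w ≡ + k
  w-[w-k] = trans (cong (ℤ._+_ (ℤ.- + (w ∸ k))) (trans (cong +_ w≡) (ℤ.pos-+ (w ∸ k) k))) (cancel (+ (w ∸ k)) (+ k))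
    where
    w≡ : w ≡ w ∸ k + k
    w≡ = sym (m∸n+n≡m (<⇒≤ (≰⇒> w≰k)))
    cancel : ∀ a b → ℤ.- a ℤ.+ (a ℤ.+ b) ≡ b
    cancel = ℤ-Solver.solve-∀

Chain⇒Covers : ∀ p ws → Covers p → Chain (sum p) ws → Covers (p ++ ws)
Chain⇒Covers p [] cover _ = subst Covers (sym (++-identityʳ p)) cover
Chain⇒Covers p (w ∷ ws) cover (w≤ , chain) = subst Covers (++-assoc p [ w ] ws)
  (Chain⇒Covers (p ∷ʳ w) ws (Covers-∷ʳ p cover w≤) (subst (λ s → Chain s ws) (sym (sum-∷ʳ p w)) chain))

Chain⇒complete : ∀ ws → Chain 0 ws → T (complete (sum ws) ws)
Chain⇒complete ws chain = Equivalence.from complete⇔ λ k _ k≤ →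
  Chain⇒Covers [] ws (λ { zero z≤n → [] }) chain k k≤

-- The deficit of a signed sum x over ws is  sum ws − x = Σ (1 − uᵢ) wᵢ.
data Deficit : List ℕ → ℕ → Set where
  []    : Deficit [] 0
  none  : ∀ {w ws d} → Deficit ws d → Deficit (w ∷ ws) d
  once  : ∀ {w ws d} → Deficit ws d → Deficit (w ∷ ws) (w + d)
  twice : ∀ {w ws d} → Deficit ws d → Deficit (w ∷ ws) (w + w + d)

deficit-balance : ∀ w d x {s} → + d ℤ.+ x ≡ + s → ∀ {y} → y ≡ + w ℤ.+ (+ d ℤ.+ x) → y ≡ + (w + s)
deficit-balance w d x {s} eq y≡ = trans y≡ (trans (cong (ℤ._+_ (+ w)) eq) (sym (ℤ.pos-+ w s)))

SignedSum⇒Deficit : ∀ {ws x} → SignedSum ws x → ∃ λ d → Deficit ws d × + d ℤ.+ x ≡ + sum ws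
SignedSum⇒Deficit [] = 0 , [] , refl
SignedSum⇒Deficit {w ∷ ws} (minus {x = x} σ) with d , δ , eq ← SignedSum⇒Deficit σ =
  w + w + d , twice δ , deficit-balance w d x eq (begin
    + (w + w + d) ℤ.+ (x - + w)          ≡⟨ cong (λ y → y ℤ.+ (x - + w)) (trans (ℤ.pos-+ (w + w) d)
                                                                         (cong (λ y → y ℤ.+ + d) (ℤ.pos-+ w w))) ⟩
    (+ w ℤ.+ + w ℤ.+ + d) ℤ.+ (x - + w)  ≡⟨ rearrange (+ w) (+ d) x ⟩
    + w ℤ.+ (+ d ℤ.+ x)                  ∎)
  where
  open ≡-Reasoning
  rearrange : ∀ a b c → (a ℤ.+ a ℤ.+ b) ℤ.+ (c - a) ≡ a ℤ.+ (b ℤ.+ c)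
  rearrange = ℤ-Solver.solve-∀
SignedSum⇒Deficit {w ∷ ws} (skip {x = x} σ) with d , δ , eq ← SignedSum⇒Deficit σ =
  w + d , once δ , deficit-balance w d x eq (trans (cong (λ y → y ℤ.+ x) (ℤ.pos-+ w d)) (ℤ.+-assoc (+ w) (+ d) x))
SignedSum⇒Deficit {w ∷ ws} (plus {x = x} σ) with d , δ , eq ← SignedSum⇒Deficit σ =
  d , none δ , deficit-balance w d x eq (rearrange (+ w) (+ d) x)
  where
  rearrange : ∀ a b c → b ℤ.+ (c ℤ.+ a) ≡ a ℤ.+ (b ℤ.+ c)
  rearrange = ℤ-Solver.solve-∀

Deficit-zero-or-≥ : ∀ {q d B} → All (B ≤_) q → Deficit q d → d ≡ 0 ⊎ B ≤ d
Deficit-zero-or-≥ _ [] = inj₁ refl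
Deficit-zero-or-≥ (_ ∷ B≤q) (none δ) = Deficit-zero-or-≥ B≤q δ
Deficit-zero-or-≥ (B≤w ∷ _) (once {w} {d = d} δ) = inj₂ (≤-trans B≤w (m≤m+n w d))
Deficit-zero-or-≥ (B≤w ∷ _) (twice {w} {d = d} δ) =
  inj₂ (≤-trans B≤w (≤-trans (m≤m+n w w) (m≤m+n (w + w) d)))

v+v+2s≡2[v+s] : ∀ v s → v + v + 2 * s ≡ 2 * (v + s)
v+v+2s≡2[v+s] = NatSolver.solve-∀

Deficit-gap : ∀ p {q d B} → All (B ≤_) q → Deficit (p ++ q) d → d ≤ 2 * sum p ⊎ B ≤ d
Deficit-gap [] B≤q δ = Data.Sum.map₁ (λ { refl → z≤n }) (Deficit-zero-or-≥ B≤q δ)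
Deficit-gap (v ∷ p) B≤q (none δ) =
  Data.Sum.map₁ (λ d≤ → ≤-trans d≤ (*-monoʳ-≤ 2 (m≤n+m (sum p) v))) (Deficit-gap p B≤q δ)
Deficit-gap (v ∷ p) B≤q (once {d = d} δ) =
  Data.Sum.map (λ d≤ → ≤-trans (+-monoʳ-≤ v d≤)
                 (≤-trans (+-monoˡ-≤ (2 * sum p) (m≤m+n v v)) (≤-reflexive (v+v+2s≡2[v+s] v (sum p)))))
               (λ B≤d → ≤-trans B≤d (m≤n+m d v)) (Deficit-gap p B≤q δ)
Deficit-gap (v ∷ p) B≤q (twice {d = d} δ) =
  Data.Sum.map (λ d≤ → ≤-trans (+-monoʳ-≤ (v + v) d≤) (≤-reflexive (v+v+2s≡2[v+s] v (sum p))))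
               (λ B≤d → ≤-trans B≤d (m≤n+m d (v + v))) (Deficit-gap p B≤q δ)

-- If w > 2S + 1, the number  n − (2S + 1)  has no signed representation: its deficit
-- 2S + 1 is too large for the parts before w and too small for w and the parts after it.
complete⇒part≤ : ∀ p w q → All (w ≤_) q →
                 (∀ k → 1 ≤ k → k ≤ sum (p ++ w ∷ q) → SignedSum (p ++ w ∷ q) (+ k)) →
                 w ≤ suc (2 * sum p)
complete⇒part≤ p w q w≤q rep = ≮⇒≥ λ u<w →
  no-deficit u<w (SignedSum⇒Deficit (rep (n ∸ u) (m<n⇒0<n∸m (u<n u<w)) (m∸n≤m n u)))
  where
  n = sum (p ++ w ∷ q)
  u = suc (2 * sum p)
  u<n : u < w → u < n
  u<n u<w = <-≤-trans u<w (begin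
    w                    ≤⟨ m≤m+n w (sum q) ⟩
    w + sum q            ≤⟨ m≤n+m (w + sum q) (sum p) ⟩
    sum p + (w + sum q)  ≡⟨ sum-++ p (w ∷ q) ⟨
    n                    ∎)
    where open ≤-Reasoning
  no-deficit : u < w → ¬ ∃ λ d → Deficit (p ++ w ∷ q) d × + d ℤ.+ + (n ∸ u) ≡ + n
  no-deficit u<w (d , δ , eq) = Data.Sum.[ n≮n (2 * sum p) ∘ subst (_≤ 2 * sum p) d≡u
                                          , <⇒≱ u<w ∘ subst (w ≤_) d≡u ]′ (Deficit-gap p (≤-refl ∷ w≤q) δ)
    where
    d≡u : d ≡ u
    d≡u = +-cancelʳ-≡ (n ∸ u) d u (trans (ℤ.+-injective (trans (ℤ.pos-+ d (n ∸ u)) eq))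
                                            (sym (m+[n∸m]≡n (<⇒≤ (u<n u<w)))))

complete⇒Chain : ∀ ws → Ascending 1 ws → T (complete (sum ws) ws) → Chain 0 ws
complete⇒Chain ws asc c = extend [] ws refl tt asc
  where
  extend : ∀ p q {m} → p ++ q ≡ ws → Chain 0 p → Ascending m q → Chain (sum p) q
  extend p [] _ _ _ = tt
  extend p (w ∷ q) refl chain (_ , asc) =
    w≤ , subst (λ s → Chain s q) (sum-∷ʳ p w)
           (extend (p ∷ʳ w) q (++-assoc p [ w ] q) (Chain-∷ʳ⁺ p chain w≤) asc)
    where
    w≤ = complete⇒part≤ p w q (Ascending⇒All≥ q asc) (Equivalence.to complete⇔ c)

-- The minimal number of parts

H : ℕ → ℕ
H zero = 0
H (suc k) = suc (3 * H k)

3^k≡1+2H : ∀ k → 3 ^ k ≡ suc (2 * H k)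
3^k≡1+2H zero = refl
3^k≡1+2H (suc k) = trans (cong (3 *_) (3^k≡1+2H k)) (triple (H k))
  where
  triple : ∀ h → 3 * suc (2 * h) ≡ suc (2 * suc (3 * h))
  triple = NatSolver.solve-∀

[3^k+1]/2≡1+H : ∀ k → (3 ^ k + 1) / 2 ≡ suc (H k)
[3^k+1]/2≡1+H k = trans (cong (λ x → (x + 1) / 2) (3^k≡1+2H k))
  (trans (cong (_/ 2) (double (H k))) (m*n/n≡m (suc (H k)) 2))
  where
  double : ∀ h → suc (2 * h) + 1 ≡ suc h * 2
  double = NatSolver.solve-∀

[3^k∸1]/2≡H : ∀ k → (3 ^ k ∸ 1) / 2 ≡ H k
[3^k∸1]/2≡H k = begin
  (3 ^ k ∸ 1) / 2         ≡⟨ cong (λ x → (x ∸ 1) / 2) {3 ^ k} (3^k≡1+2H k) ⟩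
  (suc (2 * H k) ∸ 1) / 2 ≡⟨ cong (_/ 2) (*-comm 2 (H k)) ⟩
  H k * 2 / 2             ≡⟨ m*n/n≡m (H k) 2 ⟩
  H k                     ∎
  where open ≡-Reasoning

Chain-sum≤ : ∀ {s} ws → Chain s ws → s + sum ws ≤ 3 ^ length ws * s + H (length ws)
Chain-sum≤ {s} [] _ = ≤-reflexive (padded s)
  where
  padded : ∀ s → s + 0 ≡ 1 * s + 0
  padded = NatSolver.solve-∀
Chain-sum≤ {s} (w ∷ ws) (w≤ , chain) = begin
  s + (w + sum ws)                   ≡⟨ +-assoc s w (sum ws) ⟨
  s + w + sum ws                     ≤⟨ Chain-sum≤ ws chain ⟩
  3 ^ ℓ * (s + w) + H ℓ              ≤⟨ +-monoˡ-≤ (H ℓ) (*-monoʳ-≤ (3 ^ ℓ) (+-monoʳ-≤ s w≤)) ⟩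
  3 ^ ℓ * (s + suc (2 * s)) + H ℓ    ≡⟨ rearrange (3 ^ ℓ) s (H ℓ) ⟩
  3 * 3 ^ ℓ * s + (3 ^ ℓ + H ℓ)      ≡⟨ cong (λ x → 3 * 3 ^ ℓ * s + (x + H ℓ)) (3^k≡1+2H ℓ) ⟩
  3 * 3 ^ ℓ * s + (suc (2 * H ℓ) + H ℓ) ≡⟨ cong (_+_ (3 * 3 ^ ℓ * s)) (tripled (H ℓ)) ⟩
  3 * 3 ^ ℓ * s + H (suc ℓ)          ∎
  where
  open ≤-Reasoning
  ℓ = length ws
  rearrange : ∀ p s h → p * (s + suc (2 * s)) + h ≡ 3 * p * s + (p + h)
  rearrange = NatSolver.solve-∀
  tripled : ∀ h → suc (2 * h) + h ≡ suc (3 * h)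
  tripled = NatSolver.solve-∀

Chain⇒sum≤H : ∀ ws → Chain 0 ws → sum ws ≤ H (length ws)
Chain⇒sum≤H ws chain =
  ≤-trans (Chain-sum≤ ws chain) (≤-reflexive (cong (_+ H (length ws)) (*-zeroʳ (3 ^ length ws))))

Level : ℕ → ℕ → Set
Level n zero = n ≡ 0
Level n (suc k) = H k < n × n ≤ H (suc k)

Level-prev : ∀ {n R} k → Level n (suc k) → n ≤ suc (3 * R) → R ≤ H k → Level R k
Level-prev zero _ _ R≤0 = n≤0⇒n≡0 R≤0
Level-prev (suc k) (H<n , _) n≤ R≤ =
  ≰⇒> (λ R≤H → <⇒≱ H<n (≤-trans n≤ (s≤s (*-monoʳ-≤ 3 R≤H)))) , R≤

Level-minimal : ∀ {n ℓ} k → Level n k → n ≤ H ℓ → k ≤ ℓ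
Level-minimal zero _ _ = z≤n
Level-minimal (suc k) (H<n , _) n≤H = ≰⇒> (λ ℓ≤k → <⇒≱ H<n (≤-trans n≤H (H-mono ℓ≤k)))
  where
  H-mono : ∀ {a b} → a ≤ b → H a ≤ H b
  H-mono {zero} _ = z≤n
  H-mono (s≤s a≤b) = s≤s (*-monoʳ-≤ 3 (H-mono a≤b))

Level⇒k≤n : ∀ {n} k → Level n k → k ≤ n
Level⇒k≤n zero _ = z≤n
Level⇒k≤n (suc k) (H<n , _) = ≤-trans (s≤s (k≤H k)) H<n
  where
  k≤H : ∀ k → k ≤ H k
  k≤H zero = z≤n
  k≤H (suc k) = s≤s (≤-trans (k≤H k) (m≤m+n (H k) _))

powers⇒Level : ∀ {n} k → 3 ^ k < 2 * n → 2 * n ≤ 3 ^ suc k → Level n (suc k)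
powers⇒Level {n} k 3^k< 2n≤ =
  *-cancelˡ-< 2 (H k) n (<-trans (≤-reflexive (sym (3^k≡1+2H k))) 3^k<) ,
  ≤-pred (*-cancelˡ-< 2 n (suc (H (suc k)))
    (≤-trans (s≤s (subst (2 * n ≤_) (3^k≡1+2H (suc k)) 2n≤)) (≤-reflexive (sym (*-suc 2 (H (suc k)))))))

record IsChainPartition (n k : ℕ) (ws : List ℕ) : Set where
  field
    ascending : Ascending 1 ws
    sum≡      : sum ws ≡ n
    chain     : Chain 0 ws
    length≡   : length ws ≡ k

IsChainPartition-∷ʳ : ∀ {R n k ws} → IsChainPartition R k ws → R ≤ n → n ≤ suc (3 * R) →
                      lastOr 1 ws ≤ n ∸ R → IsChainPartition n (suc k) (ws ∷ʳ (n ∸ R))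
IsChainPartition-∷ʳ {R} {n} {k} {ws} cp R≤n n≤ last≤ = record
  { ascending = Ascending-∷ʳ⁺ ws ascending last≤
  ; sum≡      = trans (sum-∷ʳ ws (n ∸ R)) (trans (cong (_+ (n ∸ R)) sum≡) (m+[n∸m]≡n R≤n))
  ; chain     = Chain-∷ʳ⁺ ws chain (subst (λ s → n ∸ R ≤ suc (2 * s)) (sym sum≡)
                  (Equivalence.from (m∸n≤1+2n⇔m≤1+3n R≤n) n≤))
  ; length≡   = trans (length-∷ʳ ws (n ∸ R)) (cong suc length≡)
  }
  where open IsChainPartition cp

record LastPartSplit (n k : ℕ) (ws : List ℕ) : Set where
  field
    R       : ℕ
    init    : List ℕ
    ws≡     : ws ≡ init ∷ʳ (n ∸ R)
    R≤n     : R ≤ n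
    n≤1+3R  : n ≤ suc (3 * R)
    ascends : lastOr 1 init ≤ n ∸ R
    init-cp : IsChainPartition R k init

IsChainPartition-split : ∀ {n k ws} → IsChainPartition n (suc k) ws → LastPartSplit n k ws
IsChainPartition-split {n} {k} {ws} cp with initLast ws | IsChainPartition.length≡ cp
... | [] | ()
... | init ∷ʳ′ w | len≡ = record
  { R       = R
  ; init    = init
  ; ws≡     = cong (init ∷ʳ_) w≡
  ; R≤n     = R≤n
  ; n≤1+3R  = Equivalence.to (m∸n≤1+2n⇔m≤1+3n R≤n) (subst (_≤ suc (2 * R)) w≡ w≤)
  ; ascends = subst (lastOr 1 init ≤_) w≡ last≤w
  ; init-cp = record { ascending = asc ; sum≡ = refl ; chain = chain′
                     ; length≡ = suc-injective (trans (sym (length-∷ʳ init w)) len≡) }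
  }
  where
  open IsChainPartition cp
  R = sum init
  R+w≡n : R + w ≡ n
  R+w≡n = trans (sym (sum-∷ʳ init w)) sum≡
  R≤n : R ≤ n
  R≤n = subst (R ≤_) R+w≡n (m≤m+n R w)
  w≡ : w ≡ n ∸ R
  w≡ = trans (sym (m+n∸m≡n R w)) (cong (_∸ R) R+w≡n)
  asc = proj₁ (Ascending-∷ʳ⁻ init ascending)
  last≤w = proj₂ (Ascending-∷ʳ⁻ init ascending)
  chain′ = proj₁ (Chain-∷ʳ⁻ init chain)
  w≤ = proj₂ (Chain-∷ʳ⁻ init chain)

-- The first k parts are a chain partition of R = ⌊(n + 1)/3⌋ = ⌈(n − 1)/3⌉.
chainPartition : ∀ {n} k → Level n k → ∃ (IsChainPartition n k)
chainPartition zero refl = [] , record { ascending = tt ; sum≡ = refl ; chain = tt ; length≡ = refl }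
chainPartition {n} (suc k) level@(H<n , n≤H) = extend (chainPartition k (Level-prev k level n≤1+3R R≤H))
  where
  open ≤-Reasoning
  shape : ∀ r → suc r * 3 ≡ suc (3 * r) + 2
  shape = NatSolver.solve-∀
  R = (n + 1) / 3
  R*3≤ : R * 3 ≤ n + 1
  R*3≤ = m/n*n≤m (n + 1) 3
  n≤1+3R : n ≤ suc (3 * R)
  n≤1+3R = +-cancelʳ-≤ 2 n (suc (3 * R)) (begin
    n + 2             ≡⟨ +-suc n 1 ⟩
    suc (n + 1)       ≤⟨ m<[1+m/n]*n (n + 1) 3 ⟩
    suc R * 3         ≡⟨ shape R ⟩
    suc (3 * R) + 2   ∎)
  R≤H : R ≤ H k
  R≤H = ≤-pred (*-cancelʳ-< 3 R (suc (H k)) (begin-strict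
    R * 3             ≤⟨ R*3≤ ⟩
    n + 1             ≤⟨ +-monoˡ-≤ 1 n≤H ⟩
    suc (3 * H k) + 1 <⟨ +-monoʳ-< (suc (3 * H k)) (n<1+n 1) ⟩
    suc (3 * H k) + 2 ≡⟨ shape (H k) ⟨
    suc (H k) * 3     ∎))
  R+R≤n : R + R ≤ n
  R+R≤n with R | R*3≤
  ... | zero | _ = z≤n
  ... | suc r | r*3≤ = +-cancelʳ-≤ 1 (suc r + suc r) n (begin
    suc r + suc r + 1     ≤⟨ +-monoʳ-≤ (suc r + suc r) (s≤s z≤n) ⟩
    suc r + suc r + suc r ≡⟨ triple r ⟩
    suc r * 3             ≤⟨ r*3≤ ⟩
    n + 1                 ∎)
    where
    triple : ∀ r → suc r + suc r + suc r ≡ suc r * 3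
    triple = NatSolver.solve-∀
  R<n : R < n
  R<n with R | R+R≤n
  ... | zero | _ = ≤-trans (s≤s z≤n) H<n
  ... | suc r | R+R≤ = ≤-trans (s≤s (m≤n+m (suc r) r)) R+R≤
  extend : ∃ (IsChainPartition R k) → ∃ (IsChainPartition n (suc k))
  extend (ws , cp) = ws ∷ʳ (n ∸ R) , IsChainPartition-∷ʳ cp (<⇒≤ R<n) n≤1+3R
    (lastOr≤ ws (m<n⇒0<n∸m R<n)
      (subst (_≤ n ∸ R) (sym (IsChainPartition.sum≡ cp)) (m+n≤o⇒m≤o∸n R R+R≤n)))

min≡⊓ : ∀ a b → min a b ≡ a ⊓ b
min≡⊓ a b with a ≤ᵇ b in eq
... | true = sym (m≤n⇒m⊓n≡m (≤ᵇ⇒≤ a b (subst T (sym eq) tt)))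
... | false = sym (m≥n⇒m⊓n≡n (≰⇒≥ (λ a≤b → subst T eq (≤⇒≤ᵇ a≤b))))

foldr-min-≥ : ∀ {k a xs} → k ≤ a → All (k ≤_) xs → k ≤ foldr min a xs
foldr-min-≥ k≤a [] = k≤a
foldr-min-≥ {k} k≤a (k≤x ∷ k≤xs) =
  subst (k ≤_) (sym (min≡⊓ _ _)) (⊓-glb k≤x (foldr-min-≥ k≤a k≤xs))

foldr-min-≤ : ∀ {a x xs} → x ∈ xs → foldr min a xs ≤ x
foldr-min-≤ {x = x} (here refl) = subst (_≤ x) (sym (min≡⊓ x _)) (m⊓n≤m x _)
foldr-min-≤ {xs = y ∷ _} (there x∈) =
  subst (_≤ _) (sym (min≡⊓ y _)) (≤-trans (m⊓n≤n y _) (foldr-min-≤ x∈))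

∈-completes⁻ : ∀ {n ws} → ws ∈ filterᵇ (complete n) (partitions n) →
               Ascending 1 ws × sum ws ≡ n × Chain 0 ws
∈-completes⁻ {n} {ws} ws∈ with ws∈ps , c ← ∈-filter⁻ (T? ∘ complete n) {xs = partitions n} ws∈
                             with asc , refl ← Equivalence.to (∈-partitions⇔ {n} {ws}) ws∈ps
  = asc , refl , complete⇒Chain ws asc c

minParts≡ : ∀ {n} k → Level n k → minParts n ≡ k
minParts≡ {n} k level = ≤-antisym upper lower
  where
  lower : k ≤ minParts n
  lower = foldr-min-≥ (Level⇒k≤n k level) (All.tabulate λ ℓ∈ →
    case ∈-map⁻ length ℓ∈ of λ { (ws , ws∈ , ℓ≡) →
      let asc , sum≡ , chain = ∈-completes⁻ ws∈ in
      subst (k ≤_) (sym ℓ≡) (Level-minimal k level (subst (_≤ H (length ws)) sum≡ (Chain⇒sum≤H ws chain))) })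
  upper : minParts n ≤ k
  upper with ws , cp ← chainPartition k level = subst (minParts n ≤_) length≡
    (foldr-min-≤ (∈-map⁺ length (∈-filter⁺ (T? ∘ complete n) ws∈ps
      (subst (λ m → T (complete m ws)) sum≡ (Chain⇒complete ws chain)))))
    where
    open IsChainPartition cp
    ws∈ps : ws ∈ partitions n
    ws∈ps = Equivalence.from ∈-partitions⇔ (ascending , sum≡)

feasibles : ℕ → List (List ℕ)
feasibles n = filterᵇ (feasible n) (partitions n)

feasibles-unique : ∀ n → Unique (feasibles n)
feasibles-unique n = Unique.filter⁺ (T? ∘ feasible n) (partsFrom-unique n 1 n)

∈-feasibles⁻ : ∀ {n ws} → ws ∈ feasibles n → Ascending 1 ws × sum ws ≡ n
∈-feasibles⁻ {n} ws∈ =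
  Equivalence.to ∈-partitions⇔ (proj₁ (∈-filter⁻ (T? ∘ feasible n) {xs = partitions n} ws∈))

∈-feasibles⇔ : ∀ {n ws} k → Level n k → ws ∈ feasibles n ⇔ IsChainPartition n k ws
∈-feasibles⇔ {n} {ws} k level = mk⇔
  (λ ws∈ → let ws∈ps , f = ∈-filter⁻ (T? ∘ feasible n) {xs = partitions n} ws∈
               c , length≡ = Equivalence.to T-∧ f
               asc , sum≡ = Equivalence.to ∈-partitions⇔ ws∈ps
           in record { ascending = asc ; sum≡ = sum≡ ; chain = complete⇒Chain ws asc (subst (λ m → T (complete m ws)) (sym sum≡) c)
                     ; length≡ = trans (toWitness length≡) (minParts≡ k level) })
  (λ cp → let open IsChainPartition cp in ∈-filter⁺ (T? ∘ feasible n) (Equivalence.from ∈-partitions⇔ (ascending , sum≡))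
            (Equivalence.from T-∧ (subst (λ m → T (complete m ws)) sum≡ (Chain⇒complete ws chain)
                                  , fromWitness (trans length≡ (sym (minParts≡ k level))))))

-- Splitting off the last part

∈-feasibles⇒lastOr≤ : ∀ {r R p} → p ∈ feasibles r → r < R → 2 * r ≤ R → lastOr 1 p ≤ R ∸ r
∈-feasibles⇒lastOr≤ {r} {R} {p} p∈ r<R 2r≤R = lastOr≤ p (m<n⇒0<n∸m r<R)
  (subst (_≤ R ∸ r) (sym (proj₂ (∈-feasibles⁻ p∈)))
    (m+n≤o⇒m≤o∸n r (subst (_≤ R) (cong (_+_ r) (+-identityʳ r)) 2r≤R)))

record FeasibleInit (n k R : ℕ) (q : List ℕ) : Set where
  field
    R≤H     : R ≤ H k
    n≤1+3R  : n ≤ suc (3 * R)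
    q∈      : q ∈ feasibles R
    ascends : lastOr 1 q ≤ n ∸ R

∈-feasibles-∷ʳ⁺ : ∀ {n R q} k → Level n (suc k) → FeasibleInit n k R q → q ∷ʳ (n ∸ R) ∈ feasibles n
∈-feasibles-∷ʳ⁺ k level@(H<n , _) init = Equivalence.from (∈-feasibles⇔ (suc k) level)
  (IsChainPartition-∷ʳ (Equivalence.to (∈-feasibles⇔ k (Level-prev k level n≤1+3R R≤H)) q∈)
                       (<⇒≤ (≤-<-trans R≤H H<n)) n≤1+3R ascends)
  where open FeasibleInit init

∈-feasibles-∷ʳ⁻ : ∀ {n ws} k → Level n (suc k) → ws ∈ feasibles n →
                  ∃₂ λ R q → ws ≡ q ∷ʳ (n ∸ R) × FeasibleInit n k R q
∈-feasibles-∷ʳ⁻ k level ws∈ =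
  R , init , ws≡ , record { R≤H = R≤H ; n≤1+3R = n≤1+3R ; ascends = ascends
                          ; q∈ = Equivalence.from (∈-feasibles⇔ k (Level-prev k level n≤1+3R R≤H)) init-cp }
  where
  open LastPartSplit (IsChainPartition-split (Equivalence.to (∈-feasibles⇔ (suc k) level) ws∈))
  open IsChainPartition init-cp
  R≤H : R ≤ H k
  R≤H = subst₂ (λ s ℓ → s ≤ H ℓ) sum≡ length≡ (Chain⇒sum≤H init chain)

extensions : ℕ → (ℕ → List (List ℕ)) → ℕ → ℕ → List (List ℕ)
extensions n F lo hi = concatMap (λ R → map (_∷ʳ (n ∸ R)) (F R)) (range lo hi)

length-extensions : ∀ n F lo hi → length (extensions n F lo hi) ≡ sumFromTo lo hi (length ∘ F)
length-extensions n F lo hi = trans (length-concatMap (λ R → map (_∷ʳ (n ∸ R)) (F R)) (range lo hi))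
  (cong sum (map-cong (λ R → length-map (_∷ʳ (n ∸ R)) (F R)) (range lo hi)))

∈-extensions⁻ : ∀ {n F lo hi z} → z ∈ extensions n F lo hi →
                ∃₂ λ R q → (lo ≤ R × R ≤ hi) × q ∈ F R × z ≡ q ∷ʳ (n ∸ R)
∈-extensions⁻ {n} {F} {lo} {hi} z∈
  with R , R∈ , z∈′ ← find (∈-concatMap⁻ (λ R → map (_∷ʳ (n ∸ R)) (F R)) {xs = range lo hi} z∈)
  with q , q∈ , z≡ ← ∈-map⁻ (_∷ʳ (n ∸ R)) z∈′
  = R , q , ∈-range⁻ R∈ , q∈ , z≡

∈-extensions⁺ : ∀ {n F lo hi R q} → lo ≤ R → R ≤ hi → q ∈ F R → q ∷ʳ (n ∸ R) ∈ extensions n F lo hi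
∈-extensions⁺ {n} {F} {R = R} lo≤R R≤hi q∈ = ∈-concatMap⁺ (λ R → map (_∷ʳ (n ∸ R)) (F R))
  (Any.map (λ { refl → ∈-map⁺ (_∷ʳ (n ∸ R)) q∈ }) (∈-range⁺ lo≤R R≤hi))

extensions-unique : ∀ {n F lo hi} → hi ≤ n → (∀ R → R ≤ hi → Unique (F R)) → Unique (extensions n F lo hi)
extensions-unique {n} {F} {lo} {hi} hi≤n F! = Unique-concatMap (λ z → n ∸ lastOr 0 z) (range-unique lo hi)
  (λ {R} R∈ → Unique.map⁺ (∷ʳ-injectiveˡ _ _) (F! R (proj₂ (∈-range⁻ R∈))))
  λ {R} R∈ z∈ → case ∈-map⁻ (_∷ʳ (n ∸ R)) z∈ of λ { (q , _ , refl) →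
    trans (cong (n ∸_) (lastOr-∷ʳ 0 q (n ∸ R))) (m∸[m∸n]≡n (≤-trans (proj₂ (∈-range⁻ R∈)) hi≤n)) }

-- The recurrence

4R≤2n+2b⇒R≤1+3b : ∀ R n b → n ≤ 5 * b + 3 → 4 * R ≤ 2 * n + 2 * b → R ≤ suc (3 * b)
4R≤2n+2b⇒R≤1+3b R n b n≤ 4R≤ = ≤-pred (*-cancelˡ-< 4 R (suc (suc (3 * b))) (begin-strict
  4 * R                     ≤⟨ 4R≤ ⟩
  2 * n + 2 * b             ≤⟨ +-monoˡ-≤ (2 * b) (*-monoʳ-≤ 2 n≤) ⟩
  2 * (5 * b + 3) + 2 * b   <⟨ m<m+n (2 * (5 * b + 3) + 2 * b) (s≤s z≤n) ⟩
  2 * (5 * b + 3) + 2 * b + 2 ≡⟨ shape b ⟩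
  4 * suc (suc (3 * b))     ∎))
  where
  open ≤-Reasoning
  shape : ∀ b → 2 * (5 * b + 3) + 2 * b + 2 ≡ 4 * suc (suc (3 * b))
  shape = NatSolver.solve-∀

2R≤n+r⇒4R≤2n+2b : ∀ R r n b → r ≤ b → 2 * R ≤ n + r → 4 * R ≤ 2 * n + 2 * b
2R≤n+r⇒4R≤2n+2b R r n b r≤b 2R≤ = begin
  4 * R          ≡⟨ *-assoc 2 2 R ⟩
  2 * (2 * R)    ≤⟨ *-monoʳ-≤ 2 2R≤ ⟩
  2 * (n + r)    ≡⟨ *-distribˡ-+ 2 n r ⟩
  2 * n + 2 * r  ≤⟨ +-monoʳ-≤ (2 * n) (*-monoʳ-≤ 2 r≤b) ⟩
  2 * n + 2 * b  ∎
  where open ≤-Reasoning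

n+r<2R⇒3n+2≤5R : ∀ R r n → n + r < 2 * R → R ≤ suc (3 * r) → 3 * n + 2 ≤ 5 * R
n+r<2R⇒3n+2≤5R R r n n+r< R≤ = +-cancelʳ-≤ R (3 * n + 2) (5 * R) (begin
  3 * n + 2 + R            ≤⟨ +-monoʳ-≤ (3 * n + 2) R≤ ⟩
  3 * n + 2 + suc (3 * r)  ≡⟨ shape n r ⟩
  3 * suc (n + r)          ≤⟨ *-monoʳ-≤ 3 n+r< ⟩
  3 * (2 * R)              ≡⟨ shape′ R ⟩
  5 * R + R                ∎)
  where
  open ≤-Reasoning
  shape : ∀ n r → 3 * n + 2 + suc (3 * r) ≡ 3 * suc (n + r)
  shape = NatSolver.solve-∀
  shape′ : ∀ R → 3 * (2 * R) ≡ 5 * R + R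
  shape′ = NatSolver.solve-∀

3n+2≤5R⇒n≤1+3R : ∀ R n → 3 * n + 2 ≤ 5 * R → n ≤ suc (3 * R)
3n+2≤5R⇒n≤1+3R R n 3n+2≤ = *-cancelˡ-≤ 3 (begin
  3 * n            ≤⟨ m≤m+n (3 * n) 2 ⟩
  3 * n + 2        ≤⟨ 3n+2≤ ⟩
  5 * R            ≤⟨ *-monoˡ-≤ R (m≤m+n 5 4) ⟩
  9 * R            ≤⟨ m≤m+n (9 * R) 3 ⟩
  9 * R + 3        ≡⟨ shape R ⟩
  3 * suc (3 * R)  ∎)
  where
  open ≤-Reasoning
  shape : ∀ R → 9 * R + 3 ≡ 3 * suc (3 * R)
  shape = NatSolver.solve-∀

3n+2≤5R⇒n<2R : ∀ R n → 3 * n + 2 ≤ 5 * R → n < 2 * R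
3n+2≤5R⇒n<2R R n 3n+2≤ = ≰⇒> λ 2R≤n → m+1+n≰m (5 * n) (begin
  5 * n + suc (n + 3)  ≡⟨ shape n ⟩
  2 * (3 * n + 2)      ≤⟨ *-monoʳ-≤ 2 3n+2≤ ⟩
  2 * (5 * R)          ≡⟨ shape′ R ⟩
  5 * (2 * R)          ≤⟨ *-monoʳ-≤ 5 2R≤n ⟩
  5 * n                ∎)
  where
  open ≤-Reasoning
  shape : ∀ n → 5 * n + suc (n + 3) ≡ 2 * (3 * n + 2)
  shape = NatSolver.solve-∀
  shape′ : ∀ R → 2 * (5 * R) ≡ 5 * (2 * R)
  shape′ = NatSolver.solve-∀

n+r<2R⇒r≤b : ∀ R r n b → n + r < 2 * R → 4 * R ≤ 2 * n + 2 * b → r ≤ b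
n+r<2R⇒r≤b R r n b n+r< 4R≤ = *-cancelˡ-≤ 2 (+-cancelˡ-≤ (2 * n) (2 * r) (2 * b) (begin
  2 * n + 2 * r        ≤⟨ m≤m+n (2 * n + 2 * r) 2 ⟩
  2 * n + 2 * r + 2    ≡⟨ shape n r ⟩
  2 * suc (n + r)      ≤⟨ *-monoʳ-≤ 2 n+r< ⟩
  2 * (2 * R)          ≡⟨ *-assoc 2 2 R ⟨
  4 * R                ≤⟨ 4R≤ ⟩
  2 * n + 2 * b        ∎))
  where
  open ≤-Reasoning
  shape : ∀ n r → 2 * n + 2 * r + 2 ≡ 2 * suc (n + r)
  shape = NatSolver.solve-∀

n+r<2R⇒2r≤R : ∀ R r n b → 3 * b + 2 ≤ n → n + r < 2 * R → 4 * R ≤ 2 * n + 2 * b → 2 * r ≤ R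
n+r<2R⇒2r≤R R r n b 3b+2≤n n+r< 4R≤ = +-cancelʳ-≤ (2 * n) (2 * r) R (begin
  2 * r + 2 * n        ≤⟨ m≤m+n (2 * r + 2 * n) 2 ⟩
  2 * r + 2 * n + 2    ≡⟨ shape n r ⟩
  2 * suc (n + r)      ≤⟨ *-monoʳ-≤ 2 n+r< ⟩
  2 * (2 * R)          ≡⟨ shape′ R ⟩
  R + 3 * R            ≤⟨ +-monoʳ-≤ R (≤-trans (m≤m+n (3 * R) 1) 3R+1≤2n) ⟩
  R + 2 * n            ∎)
  where
  open ≤-Reasoning
  shape : ∀ n r → 2 * r + 2 * n + 2 ≡ 2 * suc (n + r)
  shape = NatSolver.solve-∀
  shape′ : ∀ R → 2 * (2 * R) ≡ R + 3 * R
  shape′ = NatSolver.solve-∀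
  regroup : ∀ R → 4 * (3 * R + 1) ≡ 3 * (4 * R) + 4
  regroup = NatSolver.solve-∀
  regroup′ : ∀ n b → 3 * (2 * n + 2 * b) + 4 ≡ 6 * n + 2 * (3 * b + 2)
  regroup′ = NatSolver.solve-∀
  regroup″ : ∀ n → 6 * n + 2 * n ≡ 4 * (2 * n)
  regroup″ = NatSolver.solve-∀
  3R+1≤2n : 3 * R + 1 ≤ 2 * n
  3R+1≤2n = *-cancelˡ-≤ 4 (begin
    4 * (3 * R + 1)              ≡⟨ regroup R ⟩
    3 * (4 * R) + 4              ≤⟨ +-monoˡ-≤ 4 (*-monoʳ-≤ 3 4R≤) ⟩
    3 * (2 * n + 2 * b) + 4      ≡⟨ regroup′ n b ⟩
    6 * n + 2 * (3 * b + 2)      ≤⟨ +-monoʳ-≤ (6 * n) (*-monoʳ-≤ 2 3b+2≤n) ⟩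
    6 * n + 2 * n                ≡⟨ regroup″ n ⟩
    4 * (2 * n)                  ∎)

4R≤2n+2b⇒R≤n : ∀ R n b → b ≤ n → 4 * R ≤ 2 * n + 2 * b → R ≤ n
4R≤2n+2b⇒R≤n R n b b≤n 4R≤ = *-cancelˡ-≤ 4 (begin
  4 * R          ≤⟨ 4R≤ ⟩
  2 * n + 2 * b  ≤⟨ +-monoʳ-≤ (2 * n) (*-monoʳ-≤ 2 b≤n) ⟩
  2 * n + 2 * n  ≡⟨ shape n ⟩
  4 * n          ∎)
  where
  open ≤-Reasoning
  shape : ∀ n → 2 * n + 2 * n ≡ 4 * n
  shape = NatSolver.solve-∀

R≤1+3b⇒2R≤n+r : ∀ R r n b → 5 * b + 2 ≤ n → R ≤ suc (3 * b) → R ≤ suc (3 * r) → 2 * R ≤ n + r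
R≤1+3b⇒2R≤n+r R r n b 5b+2≤n R≤1+3b R≤1+3r = *-cancelˡ-≤ 3 (begin
  3 * (2 * R)                      ≡⟨ shape R ⟩
  5 * R + R                        ≤⟨ +-mono-≤ (*-monoʳ-≤ 5 R≤1+3b) R≤1+3r ⟩
  5 * suc (3 * b) + suc (3 * r)    ≡⟨ shape′ b r ⟩
  3 * (5 * b + 2) + 3 * r          ≤⟨ +-monoˡ-≤ (3 * r) (*-monoʳ-≤ 3 5b+2≤n) ⟩
  3 * n + 3 * r                    ≡⟨ *-distribˡ-+ 3 n r ⟨
  3 * (n + r)                      ∎)
  where
  open ≤-Reasoning
  shape : ∀ R → 3 * (2 * R) ≡ 5 * R + R
  shape = NatSolver.solve-∀
  shape′ : ∀ b r → 5 * suc (3 * b) + suc (3 * r) ≡ 3 * (5 * b + 2) + 3 * r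
  shape′ = NatSolver.solve-∀

⌈[n∸1]/3⌉≤R⇔ : ∀ {n R} → ⌈ (n ∸ 1) / 3 ⌉ ≤ R ⇔ n ≤ suc (3 * R)
⌈[n∸1]/3⌉≤R⇔ {n} {R} = mk⇔
  (λ ⌈⌉≤R → pred-bound n (subst (n ∸ 1 ≤_) (*-comm R 3) (⌈m/n⌉≤o⇒m≤o*n ⌈⌉≤R)))
  (λ n≤ → m≤o*n⇒⌈m/n⌉≤o (subst (n ∸ 1 ≤_) (*-comm 3 R) (∸-monoˡ-≤ 1 n≤)))
  where
  pred-bound : ∀ n → n ∸ 1 ≤ 3 * R → n ≤ suc (3 * R)
  pred-bound zero _ = z≤n
  pred-bound (suc n) n≤ = s≤s n≤

⌈[3n+2]/5⌉≤R⇔ : ∀ {n R} → ⌈ (3 * n + 2) / 5 ⌉ ≤ R ⇔ 3 * n + 2 ≤ 5 * R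
⌈[3n+2]/5⌉≤R⇔ {n} {R} = mk⇔
  (λ ⌈⌉≤R → subst (3 * n + 2 ≤_) (*-comm R 5) (⌈m/n⌉≤o⇒m≤o*n ⌈⌉≤R))
  (λ ≤5R → m≤o*n⇒⌈m/n⌉≤o (subst (3 * n + 2 ≤_) (*-comm 5 R) ≤5R))

R≤[2n+2b]/4⇔ : ∀ {n b R} → R ≤ (2 * n + 2 * b) / 4 ⇔ 4 * R ≤ 2 * n + 2 * b
R≤[2n+2b]/4⇔ {n} {b} {R} = mk⇔
  (λ R≤ → subst (_≤ 2 * n + 2 * b) (*-comm R 4) (m≤n/o⇒m*o≤n R≤))
  (λ 4R≤ → m*o≤n⇒m≤n/o (subst (_≤ 2 * n + 2 * b) (*-comm 4 R) 4R≤))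

n+r<2R⇒r<R : ∀ R r n → R ≤ n → n + r < 2 * R → r < R
n+r<2R⇒r<R R r n R≤n n+r< = +-cancelˡ-< n r R (≤-trans n+r< (begin
  2 * R      ≡⟨ cong (_+_ R) (+-identityʳ R) ⟩
  R + R      ≤⟨ +-monoˡ-≤ R R≤n ⟩
  n + R      ∎))
  where open ≤-Reasoning

r≤2R∸n∸1⇔ : ∀ {n r R} → n < 2 * R → r ≤ 2 * R ∸ n ∸ 1 ⇔ n + r < 2 * R
r≤2R∸n∸1⇔ {n} {r} {R} n<2R = mk⇔
  (λ r≤ → subst (_≤ 2 * R) r+1+n≡ (m≤o∸n⇒m+n≤o r n<2R (subst (r ≤_) hi≡ r≤)))
  (λ n+r< → subst (r ≤_) (sym hi≡) (m+n≤o⇒m≤o∸n r (subst (_≤ 2 * R) (sym r+1+n≡) n+r<)))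
  where
  hi≡ : 2 * R ∸ n ∸ 1 ≡ 2 * R ∸ suc n
  hi≡ = trans (∸-+-assoc (2 * R) n 1) (cong (2 * R ∸_) (+-comm n 1))
  r+1+n≡ : r + suc n ≡ suc (n + r)
  r+1+n≡ = trans (+-suc r n) (cong suc (+-comm r n))

2R∸n∸1≤R : ∀ {n R} → R ≤ n → 2 * R ∸ n ∸ 1 ≤ R
2R∸n∸1≤R {n} {R} R≤n = ≤-trans (m∸n≤m (2 * R ∸ n) 1)
  (m≤n+o⇒m∸n≤o (2 * R) n (subst (_≤ n + R) (sym (cong (_+_ R) (+-identityʳ R))) (+-monoˡ-≤ R R≤n)))

R∸r≤n∸R⇔ : ∀ {n r R} → r ≤ R → R ≤ n → R ∸ r ≤ n ∸ R ⇔ 2 * R ≤ n + r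
R∸r≤n∸R⇔ {n} {r} {R} r≤R R≤n = mk⇔
  (λ ≤n∸R → subst (_≤ n + r) R∸r+R+r≡2R (+-monoˡ-≤ r (m≤o∸n⇒m+n≤o (R ∸ r) R≤n ≤n∸R)))
  (λ 2R≤ → m+n≤o⇒m≤o∸n (R ∸ r)
    (+-cancelʳ-≤ r (R ∸ r + R) n (subst (_≤ n + r) (sym R∸r+R+r≡2R) 2R≤)))
  where
  R∸r+R+r≡2R : R ∸ r + R + r ≡ 2 * R
  R∸r+R+r≡2R = begin
    R ∸ r + R + r    ≡⟨ +-assoc (R ∸ r) R r ⟩
    R ∸ r + (R + r)  ≡⟨ cong (_+_ (R ∸ r)) (+-comm R r) ⟩
    R ∸ r + (r + R)  ≡⟨ +-assoc (R ∸ r) r R ⟨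
    R ∸ r + r + R    ≡⟨ cong (_+ R) (m∸n+n≡m r≤R) ⟩
    R + R            ≡⟨ cong (_+_ R) (+-identityʳ R) ⟨
    2 * R            ∎
    where open ≡-Reasoning

-- Feasible partitions of n have j + 2 parts, and the sum R of the first j + 1 of them is at
-- most H (j + 1) = 1 + 3b.
module LastParts (j n : ℕ) (level : Level n (suc (suc j))) where

  b = H j
  lo = ⌈ (n ∸ 1) / 3 ⌉

  3b+2≤n : 3 * b + 2 ≤ n
  3b+2≤n = subst (_≤ n) (+-comm 2 (3 * b)) (proj₁ level)

  R≤n : ∀ {R} → R ≤ suc (3 * b) → R ≤ n
  R≤n R≤ = ≤-trans R≤ (<⇒≤ (proj₁ level))

  levelBelow : ∀ {R} → lo ≤ R → R ≤ suc (3 * b) → Level R (suc j)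
  levelBelow lo≤R R≤ = Level-prev (suc j) level (Equivalence.to ⌈[n∸1]/3⌉≤R⇔ lo≤R) R≤

  ∷ʳ-feasible : ∀ {R q} → lo ≤ R → R ≤ suc (3 * b) → q ∈ feasibles R → lastOr 1 q ≤ n ∸ R →
                q ∷ʳ (n ∸ R) ∈ feasibles n
  ∷ʳ-feasible lo≤R R≤ q∈ ascends = ∈-feasibles-∷ʳ⁺ (suc j) level
    (record { R≤H = R≤ ; n≤1+3R = Equivalence.to ⌈[n∸1]/3⌉≤R⇔ lo≤R ; q∈ = q∈ ; ascends = ascends })

  feasible-view : ∀ {ws} → ws ∈ feasibles n → ∃₂ λ R q → ws ≡ q ∷ʳ (n ∸ R) × lo ≤ R × R ≤ suc (3 * b) ×
                  q ∈ feasibles R × lastOr 1 q ≤ n ∸ R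
  feasible-view ws∈ = case ∈-feasibles-∷ʳ⁻ (suc j) level ws∈ of λ where
    (R , q , ws≡ , init) → let open FeasibleInit init in
      R , q , ws≡ , Equivalence.from ⌈[n∸1]/3⌉≤R⇔ n≤1+3R , R≤H , q∈ , ascends

  last-part-view : ∀ {R q} → lo ≤ R → R ≤ suc (3 * b) → q ∈ feasibles R →
                   ∃₂ λ r p → q ≡ p ∷ʳ (R ∸ r) × r ≤ b × r < R × R ≤ suc (3 * r) × p ∈ feasibles r
  last-part-view lo≤R R≤ q∈R = case ∈-feasibles-∷ʳ⁻ j (levelBelow lo≤R R≤) q∈R of λ where
    (r , p , q≡ , init) → let open FeasibleInit init in
      r , p , q≡ , R≤H , ≤-<-trans R≤H (proj₁ (levelBelow lo≤R R≤)) , n≤1+3R , q∈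

  ascends⇔ : ∀ {R r} p → r ≤ R → R ≤ suc (3 * b) → lastOr 1 (p ∷ʳ (R ∸ r)) ≤ n ∸ R ⇔ 2 * R ≤ n + r
  ascends⇔ {R} {r} p r≤R R≤ = subst (λ x → x ≤ n ∸ R ⇔ 2 * R ≤ n + r) (sym (lastOr-∷ʳ 1 p (R ∸ r)))
    (R∸r≤n∸R⇔ r≤R (R≤n R≤))

  t≡sum-caseB : 5 * b + 2 ≤ n → t n ≡ sumFromTo lo (suc (3 * b)) t
  t≡sum-caseB 5b+2≤n = trans
    (unique-⇔-length (feasibles-unique n)
      (extensions-unique {n} {feasibles} {lo} (R≤n ≤-refl) (λ R _ → feasibles-unique R)) (mk⇔ into onto))
    (length-extensions n feasibles lo (suc (3 * b)))
    where
    into : ∀ {ws} → ws ∈ feasibles n → ws ∈ extensions n feasibles lo (suc (3 * b))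
    into ws∈ = case feasible-view ws∈ of λ where
      (R , q , refl , lo≤R , R≤ , q∈ , _) → ∈-extensions⁺ lo≤R R≤ q∈
    onto : ∀ {z} → z ∈ extensions n feasibles lo (suc (3 * b)) → z ∈ feasibles n
    onto z∈ = case ∈-extensions⁻ {n} {feasibles} {lo} {suc (3 * b)} z∈ of λ where
      (R , q , (lo≤R , R≤) , q∈ , refl) → case last-part-view lo≤R R≤ q∈ of λ where
        (r , p , refl , _ , r<R , R≤1+3r , _) → ∷ʳ-feasible lo≤R R≤ q∈
          (Equivalence.from (ascends⇔ p (<⇒≤ r<R) R≤) (R≤1+3b⇒2R≤n+r R r n b 5b+2≤n R≤ R≤1+3r))

  U = (2 * n + 2 * b) / 4
  c = ⌈ (3 * n + 2) / 5 ⌉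

  inner : ℕ → List (List ℕ)
  inner R = extensions R feasibles ⌈ (R ∸ 1) / 3 ⌉ (2 * R ∸ n ∸ 1)

  -- the extensions (p ∷ʳ (R ∸ r)) ∷ʳ (n ∸ R) whose last two parts descend
  bad : List (List ℕ)
  bad = extensions n inner c U

  U≤n : U ≤ n
  U≤n = 4R≤2n+2b⇒R≤n U n b (≤-trans (m≤n*m b 3) (≤-trans (m≤m+n (3 * b) 2) 3b+2≤n))
          (Equivalence.to (R≤[2n+2b]/4⇔ {n} {b}) ≤-refl)

  length-bad : length bad ≡ sumFromTo c U (λ R → sumFromTo ⌈ (R ∸ 1) / 3 ⌉ (2 * R ∸ n ∸ 1) t)
  length-bad = trans (length-extensions n inner c U)
    (cong sum (map-cong (λ R → length-extensions R feasibles ⌈ (R ∸ 1) / 3 ⌉ (2 * R ∸ n ∸ 1)) (range c U)))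

  bad-unique : Unique bad
  bad-unique = extensions-unique {n} {inner} {c} U≤n λ R R≤U →
    extensions-unique {R} {feasibles} {⌈ (R ∸ 1) / 3 ⌉} (2R∸n∸1≤R (≤-trans R≤U U≤n))
      (λ r _ → feasibles-unique r)

  module CaseA (n≤5b+3 : n ≤ 5 * b + 3) where

    4R≤ : ∀ {R} → R ≤ U → 4 * R ≤ 2 * n + 2 * b
    4R≤ = Equivalence.to (R≤[2n+2b]/4⇔ {n} {b})

    R≤1+3b : ∀ {R} → R ≤ U → R ≤ suc (3 * b)
    R≤1+3b {R} R≤U = 4R≤2n+2b⇒R≤1+3b R n b n≤5b+3 (4R≤ R≤U)

    ∈-bad⁺ : ∀ {R r p} → lo ≤ R → R ≤ U → R ≤ suc (3 * r) → n + r < 2 * R → p ∈ feasibles r →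
             (p ∷ʳ (R ∸ r)) ∷ʳ (n ∸ R) ∈ bad
    ∈-bad⁺ {R} {r} lo≤R R≤U R≤1+3r n+r<2R p∈ =
      ∈-extensions⁺ {n} {inner} (Equivalence.from (⌈[3n+2]/5⌉≤R⇔ {n} {R}) 3n+2≤5R) R≤U
        (∈-extensions⁺ {R} {feasibles} (Equivalence.from (⌈[n∸1]/3⌉≤R⇔ {R} {r}) R≤1+3r)
          (Equivalence.from (r≤2R∸n∸1⇔ {n} {r} {R} (3n+2≤5R⇒n<2R R n 3n+2≤5R)) n+r<2R) p∈)
      where
      3n+2≤5R = n+r<2R⇒3n+2≤5R R r n n+r<2R R≤1+3r

    inner-view : ∀ {R r p} → c ≤ R → R ≤ U → ⌈ (R ∸ 1) / 3 ⌉ ≤ r → r ≤ 2 * R ∸ n ∸ 1 → p ∈ feasibles r →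
                 lo ≤ R × r < R × n + r < 2 * R × p ∷ʳ (R ∸ r) ∈ feasibles R
    inner-view {R} {r} c≤R R≤U lo′≤r r≤hi p∈ =
      lo≤R , r<R , n+r<2R , ∈-feasibles-∷ʳ⁺ j (levelBelow lo≤R (R≤1+3b R≤U)) (record
        { R≤H = n+r<2R⇒r≤b R r n b n+r<2R (4R≤ R≤U)
        ; n≤1+3R = Equivalence.to (⌈[n∸1]/3⌉≤R⇔ {R} {r}) lo′≤r
        ; q∈ = p∈
        ; ascends = ∈-feasibles⇒lastOr≤ p∈ r<R (n+r<2R⇒2r≤R R r n b 3b+2≤n n+r<2R (4R≤ R≤U)) })
      where
      3n+2≤5R = Equivalence.to (⌈[3n+2]/5⌉≤R⇔ {n} {R}) c≤R
      n+r<2R = Equivalence.to (r≤2R∸n∸1⇔ {n} {r} {R} (3n+2≤5R⇒n<2R R n 3n+2≤5R)) r≤hi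
      lo≤R = Equivalence.from (⌈[n∸1]/3⌉≤R⇔ {n} {R}) (3n+2≤5R⇒n≤1+3R R n 3n+2≤5R)
      r<R = n+r<2R⇒r<R R r n (R≤n (R≤1+3b R≤U)) n+r<2R

    bad-view : ∀ {z} → z ∈ bad → ∃₂ λ R r → ∃ λ p → z ≡ (p ∷ʳ (R ∸ r)) ∷ʳ (n ∸ R) ×
               lo ≤ R × R ≤ U × r < R × n + r < 2 * R × p ∷ʳ (R ∸ r) ∈ feasibles R
    bad-view z∈ = case ∈-extensions⁻ {n} {inner} {c} {U} z∈ of λ where
      (R , y , (c≤R , R≤U) , y∈ , refl) →
        case ∈-extensions⁻ {R} {feasibles} {⌈ (R ∸ 1) / 3 ⌉} {2 * R ∸ n ∸ 1} y∈ of λ where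
          (r , p , (lo′≤r , r≤hi) , p∈ , refl) → case inner-view c≤R R≤U lo′≤r r≤hi p∈ of λ where
            (lo≤R , r<R , n+r<2R , q∈) → R , r , p , refl , lo≤R , R≤U , r<R , n+r<2R , q∈

    classify : ∀ {z} → z ∈ extensions n feasibles lo U → z ∈ feasibles n ⊎ z ∈ bad
    classify z∈ = case ∈-extensions⁻ {n} {feasibles} {lo} {U} z∈ of λ where
      (R , q , (lo≤R , R≤U) , q∈ , refl) → case last-part-view lo≤R (R≤1+3b R≤U) q∈ of λ where
        (r , p , refl , _ , r<R , R≤1+3r , p∈) → case 2 * R ≤? n + r of λ where
          (yes 2R≤) → inj₁ (∷ʳ-feasible lo≤R (R≤1+3b R≤U) q∈
                             (Equivalence.from (ascends⇔ p (<⇒≤ r<R) (R≤1+3b R≤U)) 2R≤))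
          (no 2R≰) → inj₂ (∈-bad⁺ lo≤R R≤U R≤1+3r (≰⇒> 2R≰) p∈)

    unclassify : ∀ {z} → z ∈ feasibles n ⊎ z ∈ bad → z ∈ extensions n feasibles lo U
    unclassify (inj₁ z∈) = case feasible-view z∈ of λ where
      (R , q , refl , lo≤R , R≤ , q∈ , ascends) → case last-part-view lo≤R R≤ q∈ of λ where
        (r , p , refl , r≤b , r<R , _ , _) → ∈-extensions⁺ {n} {feasibles} lo≤R
          (Equivalence.from (R≤[2n+2b]/4⇔ {n} {b})
            (2R≤n+r⇒4R≤2n+2b R r n b r≤b (Equivalence.to (ascends⇔ p (<⇒≤ r<R) R≤) ascends))) q∈
    unclassify (inj₂ z∈) = case bad-view z∈ of λ where
      (R , r , p , refl , lo≤R , R≤U , _ , _ , q∈) → ∈-extensions⁺ {n} {feasibles} lo≤R R≤U q∈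

    disjoint : ∀ {z} → ¬ (z ∈ feasibles n × z ∈ bad)
    disjoint (z∈ , z∈bad) = case bad-view z∈bad of λ where
      (R , r , p , refl , _ , R≤U , r<R , n+r<2R , _) →
        <⇒≱ n+r<2R (Equivalence.to (ascends⇔ p (<⇒≤ r<R) (R≤1+3b R≤U))
          (proj₂ (Ascending-∷ʳ⁻ (p ∷ʳ (R ∸ r)) (proj₁ (∈-feasibles⁻ {n} z∈)))))

    t+bad≡sum : t n + length bad ≡ sumFromTo lo U t
    t+bad≡sum = begin
      t n + length bad                      ≡⟨ length-++ (feasibles n) ⟨
      length (feasibles n ++ bad)           ≡⟨ unique-⇔-length (Unique.++⁺ (feasibles-unique n) bad-unique disjoint)
                                                 (extensions-unique {n} {feasibles} {lo} U≤n (λ R _ → feasibles-unique R))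
                                                 (mk⇔ (unclassify ∘ ∈-++⁻ (feasibles n))
                                                      (Data.Sum.[ ∈-++⁺ˡ , ∈-++⁺ʳ (feasibles n) ]′ ∘ classify)) ⟩
      length (extensions n feasibles lo U)  ≡⟨ length-extensions n feasibles lo U ⟩
      sumFromTo lo U t                      ∎
      where open ≡-Reasoning

theorem6 : (n m : ℕ) → 2 ≤ n → 3 ^ (m ∸ 1) < 2 * n → 2 * n ≤ 3 ^ m →
    ((3 ^ (m ∸ 1) + 1) / 2 ≤ n → n ≤ (3 ^ (m ∸ 1) + 1) / 2 + 3 ^ (m ∸ 2) →
    + t n ≡ + sumFromTo ⌈ (n ∸ 1) / 3 ⌉ ((2 * n + 3 ^ (m ∸ 2) ∸ 1) / 4) t
    - + sumFromTo ⌈ (3 * n + 2) / 5 ⌉ ((2 * n + 3 ^ (m ∸ 2) ∸ 1) / 4)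
    (λ R → sumFromTo ⌈ (R ∸ 1) / 3 ⌉ (2 * R ∸ n ∸ 1) t))
    × ((3 ^ (m ∸ 1) + 1) / 2 + 3 ^ (m ∸ 2) + 1 ≤ n → n ≤ (3 ^ m ∸ 1) / 2 →
    t n ≡ sumFromTo ⌈ (n ∸ 1) / 3 ⌉ ((3 ^ (m ∸ 1) ∸ 1) / 2) t)
theorem6 n zero 2≤n _ 2n≤1 = ⊥-elim (<⇒≱ (≤-trans (s≤s (s≤s z≤n)) (*-monoʳ-≤ 2 2≤n)) 2n≤1)
theorem6 n (suc zero) 2≤n _ 2n≤3 = ⊥-elim (<⇒≱ (*-monoʳ-≤ 2 2≤n) 2n≤3)
theorem6 n (suc (suc j)) _ 3^<2n 2n≤3^ = case-a , case-b
  where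
  open LastParts j n (powers⇒Level (suc j) 3^<2n 2n≤3^)
  threshold : (3 ^ suc j + 1) / 2 + 3 ^ j ≡ 5 * b + 3
  threshold = trans (cong₂ _+_ ([3^k+1]/2≡1+H (suc j)) (3^k≡1+2H j)) (shape b)
    where
    shape : ∀ b → suc (suc (3 * b)) + suc (2 * b) ≡ 5 * b + 3
    shape = NatSolver.solve-∀
  U≡ : (2 * n + 3 ^ j ∸ 1) / 4 ≡ U
  U≡ = trans (cong (λ x → (2 * n + x ∸ 1) / 4) (3^k≡1+2H j)) (cong (λ x → (x ∸ 1) / 4) (+-suc (2 * n) (2 * b)))
  case-a = λ _ n≤ → let open CaseA (subst (n ≤_) threshold n≤) in
    subst (λ u → + t n ≡ + sumFromTo lo u t - + sumFromTo c u (λ R → sumFromTo ⌈ (R ∸ 1) / 3 ⌉ (2 * R ∸ n ∸ 1) t))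
      (sym U≡) (trans (sym (+[m+n]-+n≡+m (t n) (length bad))) (cong₂ (λ x y → + x - + y) t+bad≡sum length-bad))
  case-b = λ n≥ _ → trans
    (t≡sum-caseB (≤-trans (+-monoʳ-≤ (5 * b) (n≤1+n 2)) (≤-trans (m≤m+n (5 * b + 3) 1) (subst (_≤ n) (cong (_+ 1) threshold) n≥))))
    (cong (λ u → sumFromTo lo u t) (sym ([3^k∸1]/2≡H (suc j))))
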